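{- Let $p$ be a prime and let $r\ge1$, $s\ge0$ be integers. Then $L(p^r,p^s)=p^{r+s}$.
   Context: For integers $n\ge1$, $m\ge1$, $L(n,m)$ is the smallest integer $t\ge m+1$ such that $\binom{t}{m}\equiv 0\pmod n$. -}

module Defs where

open import Data.Nat using (ℕ; suc; _≤_; _<_)
open import Data.Nat.Divisibility using (_∣_)
open import Data.Nat.Combinatorics using (_C_)
open import Data.Product using (_×_)
open import Relation.Nullary using (¬_)

-- IsL n m t : t is the smallest integer t ≥ m+1 with  C(t,m) ≡ 0 (mod n),
-- i.e. t = L(n,m).
IsL : ℕ → ℕ → ℕ → Set
IsL n m t =
  (suc m ≤ t) × (n ∣ (t C m)) × (∀ u → suc m ≤ u → u < t → ¬ (n ∣ (u C m)))

module Submission where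

-- Write q = p ^ s. The identity (d+1)·C(q+d+1, q) = (q+d+1)·C(q+d, q) lets us walk
-- C(u, q) up from u = q. When q ∤ d+1 the factor (q+d+1)/(d+1) is a p-adic unit,
-- since adding p ^ s does not change the p-adic valuation of a number it does not
-- divide; when d+1 = c·q the factor is (c+1)/c. Hence C(u, q) has the p-adic
-- valuation of ⌊u/q⌋, and p ^ r first divides it at ⌊u/q⌋ = p ^ r, i.e. u = p ^ (r+s).

open import Defs
open import Data.Nat using (ℕ; _+_; _^_; _≥_)
open import Data.Nat.Primality using (Prime)

open import Data.Nat.Base
open import Data.Nat.Properties
open import Data.Nat.Divisibility
open import Data.Nat.DivMod
open import Data.Nat.Combinatorics
open import Data.Nat.Primality
open import Data.Product using (_,_)
open import Data.Sum using (inj₁; inj₂)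
open import Relation.Nullary using (¬_; yes; no; contradiction)
open import Relation.Binary.PropositionalEquality
open import Data.Nat.Solver using (module +-*-Solver)
open +-*-Solver using (solve; _:+_; _:*_; _:=_)

[k+1]*[n+1]C[k+1]≡[n+1]*nCk : ∀ n k → suc k * (suc n C suc k) ≡ suc n * (n C k)
[k+1]*[n+1]C[k+1]≡[n+1]*nCk zero zero = refl
[k+1]*[n+1]C[k+1]≡[n+1]*nCk zero (suc k)
  rewrite k>n⇒nCk≡0 {1} {suc (suc k)} (s≤s (s≤s z≤n))
        | k>n⇒nCk≡0 {0} {suc k} (s≤s z≤n)
        | *-zeroʳ (suc (suc k)) = refl
[k+1]*[n+1]C[k+1]≡[n+1]*nCk (suc n) zero
  rewrite nC1≡n (suc (suc n)) | *-identityʳ (suc (suc n)) | +-identityʳ n = refl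
[k+1]*[n+1]C[k+1]≡[n+1]*nCk (suc n) (suc k) = begin
  suc (suc k) * (suc m C suc (suc k))                    ≡⟨ cong (suc (suc k) *_) (sym (nCk+nC[k+1]≡[n+1]C[k+1] m (suc k))) ⟩
  suc (suc k) * (m C suc k + m C suc (suc k))            ≡⟨ *-distribˡ-+ (suc (suc k)) (m C suc k) (m C suc (suc k)) ⟩
  (m C suc k + suc k * (m C suc k)) + suc (suc k) * (m C suc (suc k))
    ≡⟨ cong₂ (λ x y → (m C suc k + x) + y) ([k+1]*[n+1]C[k+1]≡[n+1]*nCk n k) ([k+1]*[n+1]C[k+1]≡[n+1]*nCk n (suc k)) ⟩
  (m C suc k + m * (n C k)) + m * (n C suc k)            ≡⟨ +-assoc (m C suc k) _ _ ⟩
  m C suc k + (m * (n C k) + m * (n C suc k))            ≡⟨ cong (m C suc k +_) (sym (*-distribˡ-+ m (n C k) (n C suc k))) ⟩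
  m C suc k + m * (n C k + n C suc k)                    ≡⟨ cong (λ x → m C suc k + m * x) (nCk+nC[k+1]≡[n+1]C[k+1] n k) ⟩
  suc m * (m C suc k)                                    ∎
  where
  open ≡-Reasoning
  m = suc n

[d+1]*[m+d+1]Cm≡[m+d+1]*[m+d]Cm : ∀ m d → suc d * (suc (m + d) C m) ≡ suc (m + d) * ((m + d) C m)
[d+1]*[m+d+1]Cm≡[m+d+1]*[m+d]Cm zero    d = refl
[d+1]*[m+d+1]Cm≡[m+d+1]*[m+d]Cm (suc k) d = +-cancelˡ-≡ (suc k * X) _ _ (begin
  suc k * X + suc d * X                          ≡⟨ sym (*-distribʳ-+ X (suc k) (suc d)) ⟩
  (suc k + suc d) * X                            ≡⟨ cong (_* X) (+-suc (suc k) d) ⟩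
  suc n * X                                      ≡⟨ cong (suc n *_) (sym (nCk+nC[k+1]≡[n+1]C[k+1] n k)) ⟩
  suc n * (n C k + n C suc k)                    ≡⟨ *-distribˡ-+ (suc n) (n C k) (n C suc k) ⟩
  suc n * (n C k) + suc n * (n C suc k)          ≡⟨ cong (_+ suc n * (n C suc k)) (sym ([k+1]*[n+1]C[k+1]≡[n+1]*nCk n k)) ⟩
  suc k * X + suc n * (n C suc k)                ∎)
  where
  open ≡-Reasoning
  n = suc k + d
  X = suc n C suc k

module Valuation {p : ℕ} (p-prime : Prime p) where

  private instance
    p≢0 : NonZero p
    p≢0 = prime⇒nonZero p-prime

  infix 4 _∼_

  -- Equality up to factors prime to p: for nonzero m and n, m ∼ n says
  -- that m and n have the same p-adic valuation.
  record _∼_ (m n : ℕ) : Set where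
    constructor cofactors
    field
      g h : ℕ
      p∤g : ¬ p ∣ g
      p∤h : ¬ p ∣ h
      mg≡nh : m * g ≡ n * h

  ∤1 : ¬ p ∣ 1
  ∤1 p∣1 = ¬prime[1] (subst Prime (∣1⇒≡1 p∣1) p-prime)

  ∤-* : ∀ {m n} → ¬ p ∣ m → ¬ p ∣ n → ¬ p ∣ m * n
  ∤-* {m} {n} p∤m p∤n p∣mn with euclidsLemma m n p-prime p∣mn
  ... | inj₁ p∣m = p∤m p∣m
  ... | inj₂ p∣n = p∤n p∣n

  ∼-reflexive : ∀ {m n} → m ≡ n → m ∼ n
  ∼-reflexive refl = cofactors 1 1 ∤1 ∤1 refl

  ∼-sym : ∀ {m n} → m ∼ n → n ∼ m
  ∼-sym (cofactors g h p∤g p∤h eq) = cofactors h g p∤h p∤g (sym eq)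

  ∼-trans : ∀ {m n o} → m ∼ n → n ∼ o → m ∼ o
  ∼-trans {m} {n} {o} (cofactors g h p∤g p∤h mg≡nh) (cofactors g′ h′ p∤g′ p∤h′ ng′≡oh′) =
    cofactors (g * g′) (h * h′) (∤-* p∤g p∤g′) (∤-* p∤h p∤h′) (begin
      m * (g * g′)   ≡⟨ sym (*-assoc m g g′) ⟩
      m * g * g′     ≡⟨ cong (_* g′) mg≡nh ⟩
      n * h * g′     ≡⟨ x*y*z≡x*z*y n h g′ ⟩
      n * g′ * h     ≡⟨ cong (_* h) ng′≡oh′ ⟩
      o * h′ * h     ≡⟨ x*y*z≡x*z*y o h′ h ⟩
      o * h * h′     ≡⟨ *-assoc o h h′ ⟩
      o * (h * h′)   ∎)
    where
    open ≡-Reasoning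
    x*y*z≡x*z*y : ∀ x y z → x * y * z ≡ x * z * y
    x*y*z≡x*z*y = solve 3 (λ x y z → x :* y :* z := x :* z :* y) refl

  ∼-*ˡ : ∀ c {m n} → m ∼ n → c * m ∼ c * n
  ∼-*ˡ c {m} {n} (cofactors g h p∤g p∤h eq) = cofactors g h p∤g p∤h
    (trans (*-assoc c m g) (trans (cong (c *_) eq) (sym (*-assoc c n h))))

  ∼-*ʳ : ∀ c {m n} → m ∼ n → m * c ∼ n * c
  ∼-*ʳ c {m} {n} m∼n = ∼-trans (∼-reflexive (*-comm m c)) (∼-trans (∼-*ˡ c m∼n) (∼-reflexive (*-comm c n)))

  ∼-cancelˡ : ∀ c .{{_ : NonZero c}} {m n} → c * m ∼ c * n → m ∼ n
  ∼-cancelˡ c {m} {n} (cofactors g h p∤g p∤h eq) = cofactors g h p∤g p∤h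
    (*-cancelˡ-≡ (m * g) (n * h) c
      (trans (sym (*-assoc c m g)) (trans eq (*-assoc c n h))))

  ∤∧∤⇒∼ : ∀ {m n} → ¬ p ∣ m → ¬ p ∣ n → m ∼ n
  ∤∧∤⇒∼ {m} {n} p∤m p∤n = cofactors n m p∤n p∤m (*-comm m n)

  p^k∣m*g⇒p^k∣m : ∀ k {m g} → ¬ p ∣ g → p ^ k ∣ m * g → p ^ k ∣ m
  p^k∣m*g⇒p^k∣m zero    _   _ = 1∣ _
  p^k∣m*g⇒p^k∣m (suc k) {m} {g} p∤g p^[1+k]∣mg
    with euclidsLemma m g p-prime (m*n∣⇒m∣ p (p ^ k) p^[1+k]∣mg)
  ... | inj₂ p∣g = contradiction p∣g p∤g
  ... | inj₁ (divides m′ refl) = subst (p * p ^ k ∣_) (*-comm p m′)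
          (*-monoʳ-∣ p (p^k∣m*g⇒p^k∣m k p∤g (*-cancelˡ-∣ p
            (subst (p * p ^ k ∣_) (x*y*z≡y*[x*z] m′ p g) p^[1+k]∣mg))))
    where
    x*y*z≡y*[x*z] : ∀ x y z → x * y * z ≡ y * (x * z)
    x*y*z≡y*[x*z] = solve 3 (λ x y z → x :* y :* z := y :* (x :* z)) refl

  ∼-resp-^∣ : ∀ k {m n} → m ∼ n → p ^ k ∣ m → p ^ k ∣ n
  ∼-resp-^∣ k {m} {n} (cofactors g h _ p∤h mg≡nh) p^k∣m =
    p^k∣m*g⇒p^k∣m k p∤h (subst (p ^ k ∣_) mg≡nh (∣m⇒∣m*n g p^k∣m))

  p^s+d∼d : ∀ s {d} → ¬ p ^ s ∣ d → p ^ s + d ∼ d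
  p^s+d∼d zero            p^0∤d = contradiction (1∣ _) p^0∤d
  p^s+d∼d (suc s) {d} p^[1+s]∤d with p ∣? d
  ... | no p∤d = ∤∧∤⇒∼ (λ p∣p^[1+s]+d → p∤d (∣m+n∣m⇒∣n p∣p^[1+s]+d (m∣m*n (p ^ s)))) p∤d
  ... | yes (divides d′ refl) =
    ∼-trans (∼-reflexive (sym p*[p^s+d′]≡p^[1+s]+d′*p))
      (∼-trans (∼-*ˡ p (p^s+d∼d s p^s∤d′)) (∼-reflexive (*-comm p d′)))
    where
    p*[p^s+d′]≡p^[1+s]+d′*p : p * (p ^ s + d′) ≡ p ^ suc s + d′ * p
    p*[p^s+d′]≡p^[1+s]+d′*p = trans (*-distribˡ-+ p (p ^ s) d′) (cong (p ^ suc s +_) (*-comm p d′))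
    p^s∤d′ : ¬ p ^ s ∣ d′
    p^s∤d′ p^s∣d′ = p^[1+s]∤d (subst (p ^ suc s ∣_) (*-comm p d′) (*-monoʳ-∣ p p^s∣d′))

  module _ (s : ℕ) where

    private
      q = p ^ s
      instance
        q≢0 : NonZero q
        q≢0 = m^n≢0 p s

    [q+d+1]Cq∼[q+d]Cq : ∀ d → ¬ q ∣ suc d → (suc (q + d) C q) ∼ ((q + d) C q)
    [q+d+1]Cq∼[q+d]Cq d q∤d+1 = ∼-cancelˡ (suc d) (∼-trans
      (∼-reflexive ([d+1]*[m+d+1]Cm≡[m+d+1]*[m+d]Cm q d))
      (∼-*ʳ ((q + d) C q) (∼-trans (∼-reflexive (sym (+-suc q d))) (p^s+d∼d s q∤d+1))))

    [q+d+1]Cq∼c+1 : ∀ c d → suc d ≡ c * q → ((q + d) C q) ∼ c → (suc (q + d) C q) ∼ suc c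
    [q+d+1]Cq∼c+1 c d d+1≡cq [q+d]Cq∼c = ∼-cancelˡ (c * q) {{cq≢0}} (∼-trans
      (∼-reflexive (begin
        c * q * (suc (q + d) C q)            ≡⟨ cong (_* (suc (q + d) C q)) (sym d+1≡cq) ⟩
        suc d * (suc (q + d) C q)            ≡⟨ [d+1]*[m+d+1]Cm≡[m+d+1]*[m+d]Cm q d ⟩
        suc (q + d) * ((q + d) C q)          ≡⟨ cong (_* ((q + d) C q)) q+d+1≡[c+1]q ⟩
        suc c * q * ((q + d) C q)            ∎))
      (∼-trans (∼-*ˡ (suc c * q) [q+d]Cq∼c) (∼-reflexive (x*y*z≡z*y*x (suc c) q c))))
      where
      open ≡-Reasoning
      cq≢0 : NonZero (c * q)
      cq≢0 = subst NonZero d+1≡cq _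
      q+d+1≡[c+1]q : suc (q + d) ≡ suc c * q
      q+d+1≡[c+1]q = trans (sym (+-suc q d)) (cong (q +_) d+1≡cq)
      x*y*z≡z*y*x : ∀ x y z → x * y * z ≡ z * y * x
      x*y*z≡z*y*x = solve 3 (λ x y z → x :* y :* z := z :* y :* x) refl

    [q+[b+aq]]Cq∼a+1 : ∀ a b → b < q → ((q + (b + a * q)) C q) ∼ suc a
    [q+[b+aq]]Cq∼a+1 zero zero _ =
      ∼-reflexive (trans (cong (_C q) (+-identityʳ q)) (nCn≡1 q))
    [q+[b+aq]]Cq∼a+1 (suc a) zero _ = ∼-trans
      (∼-reflexive (cong (_C q) (sym q+d+1≡q+[q+aq])))
      ([q+d+1]Cq∼c+1 (suc a) d d+1≡q+aq ([q+[b+aq]]Cq∼a+1 a (pred q) pred[q]<q))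
      where
      d = pred q + a * q
      d+1≡q+aq : suc d ≡ q + a * q
      d+1≡q+aq = cong (_+ a * q) (suc-pred q)
      q+d+1≡q+[q+aq] : suc (q + d) ≡ q + (q + a * q)
      q+d+1≡q+[q+aq] = trans (sym (+-suc q d)) (cong (q +_) d+1≡q+aq)
      pred[q]<q : pred q < q
      pred[q]<q = subst (pred q <_) (suc-pred q) (n<1+n (pred q))
    [q+[b+aq]]Cq∼a+1 a (suc b) b+1<q = ∼-trans
      (∼-reflexive (cong (_C q) (+-suc q (b + a * q))))
      (∼-trans ([q+d+1]Cq∼[q+d]Cq (b + a * q) q∤b+1+aq)
               ([q+[b+aq]]Cq∼a+1 a b (<-trans (n<1+n b) b+1<q)))
      where
      q∤b+1+aq : ¬ q ∣ suc b + a * q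
      q∤b+1+aq q∣b+1+aq = >⇒∤ b+1<q
        (∣m+n∣m⇒∣n (subst (q ∣_) (+-comm (suc b) (a * q)) q∣b+1+aq) (n∣m*n a))

    Cq∼/q : ∀ u → q ≤ u → (u C q) ∼ u / q
    Cq∼/q u q≤u with u / q | m≡m%n+[m/n]*n u q | m≥n⇒m/n>0 {u} {q} q≤u
    ... | zero  | _            | ()
    ... | suc a | u≡u%q+[a+1]q | _  = ∼-trans
      (∼-reflexive (cong (_C q) (trans u≡u%q+[a+1]q (x+[y+z]≡y+[x+z] (u % q) q (a * q)))))
      ([q+[b+aq]]Cq∼a+1 a (u % q) (m%n<n u q))
      where
      x+[y+z]≡y+[x+z] : ∀ x y z → x + (y + z) ≡ y + (x + z)
      x+[y+z]≡y+[x+z] = solve 3 (λ x y z → x :+ (y :+ z) := y :+ (x :+ z)) refl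

proposition7 : (p r s : ℕ) → Prime p → r ≥ 1 → IsL (p ^ r) (p ^ s) (p ^ (r + s))
proposition7 p r s p-prime r≥1 = q<p^[r+s] , p^r∣p^[r+s]Cq , p^r∤uCq
  where
  open Valuation p-prime
  instance
    p≢0 : NonZero p
    p≢0 = prime⇒nonZero p-prime
    q≢0 : NonZero (p ^ s)
    q≢0 = m^n≢0 p s
  q = p ^ s
  p^[r+s]≡p^r*q : p ^ (r + s) ≡ p ^ r * q
  p^[r+s]≡p^r*q = ^-distribˡ-+-* p r s
  1<p^r : 1 < p ^ r
  1<p^r = ^-monoʳ-< p (nonTrivial⇒n>1 p {{prime⇒nonTrivial p-prime}}) r≥1
  q<p^[r+s] : q < p ^ (r + s)
  q<p^[r+s] = subst (q <_) (trans (*-comm q (p ^ r)) (sym p^[r+s]≡p^r*q)) (m<m*n q (p ^ r) 1<p^r)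
  p^r∣p^[r+s]Cq : p ^ r ∣ (p ^ (r + s) C q)
  p^r∣p^[r+s]Cq = ∼-resp-^∣ r (∼-sym (∼-trans
    (Cq∼/q s (p ^ (r + s)) (<⇒≤ q<p^[r+s]))
    (∼-reflexive (trans (/-congˡ p^[r+s]≡p^r*q) (m*n/n≡m (p ^ r) q))))) ∣-refl
  p^r∤uCq : ∀ u → q < u → u < p ^ (r + s) → ¬ p ^ r ∣ (u C q)
  p^r∤uCq u q<u u<p^[r+s] p^r∣uCq = <⇒≱ u/q<p^r (∣⇒≤ {{>-nonZero (m≥n⇒m/n>0 (<⇒≤ q<u))}}
    (∼-resp-^∣ r (Cq∼/q s u (<⇒≤ q<u)) p^r∣uCq))
    where
    u/q<p^r : u / q < p ^ r
    u/q<p^r = m<n*o⇒m/o<n (subst (u <_) p^[r+s]≡p^r*q u<p^[r+s])
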